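{- Every typable $\lambda\mu$-term is weakly normalizable for $\beta\mu\mu'\rho\varepsilon\theta$-reduction: if $M\in\mathcal{T}_t$, then $M\in\mathcal{WN}_{\beta\mu\mu'\rho\varepsilon\theta}$.
   Context: $\lambda\mu$-terms: $\mathcal{T} ::= x \mid \lambda x.\mathcal{T} \mid (\mathcal{T})\mathcal{T} \mid [\alpha]\mathcal{T} \mid \mu\alpha.\mathcal{T}$ ($x$ $\lambda$-variables, $\alpha$ $\mu$-variables), up to renaming of bound variables; substitutions avoid capture. Types: $A ::= X \mid \bot \mid A\to B$. Typing judgments $\Gamma\vdash M:A;\Theta$ derived by: $\Gamma,x:A\vdash x:A;\Theta$; from $\Gamma,x:A\vdash M:B;\Theta$ infer $\Gamma\vdash\lambda x.M:A\to B;\Theta$; from $\Gamma\vdash M:A\to B;\Theta$ and $\Gamma\vdash N:A;\Theta$ infer $\Gamma\vdash(M)N:B;\Theta$; from $\Gamma\vdash M:A;\alpha:A,\Theta$ infer $\Gamma\vdash[\alpha]M:\bot;\alpha:A,\Theta$; from $\Gamma\vdash M:\bot;\alpha:A,\Theta$ infer $\Gamma\vdash\mu\alpha.M:A;\Theta$. $\mathcal{T}_t$ = typable terms. $M[x:=N]$ usual substitution; $M[\alpha:=\beta]$ renames free $\alpha$ to $\beta$; $M[\alpha:=_rN]$ (resp. $M[\alpha:=_lN]$) replaces inductively every subterm $[\alpha]P$ by $[\alpha](P')N$ (resp. $[\alpha](N)P'$), $P'$ the substituted $P$; $M_\alpha$ replaces inductively every subterm $[\alpha]P$ by $P$. Rules: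 $\beta$: $(\lambda x.M)N\to M[x:=N]$; $\mu$: $(\mu\alpha.M)N\to\mu\alpha.M[\alpha:=_rN]$; $\mu'$: $(N)\mu\alpha.M\to\mu\alpha.M[\alpha:=_lN]$; $\rho$: $[\beta]\mu\alpha.M\to M[\alpha:=\beta]$; $\theta$: $\mu\alpha.[\alpha]M\to M$ if $\alpha$ not free in $M$; $\varepsilon$: $\mu\alpha.\mu\beta.M\to\mu\alpha.M_\beta$. One-step reduction contracts one redex anywhere; $\mathcal{WN}_{\mathcal{R}}$ is the set of terms that reduce in finitely many steps to a term containing no redex of the rules in $\mathcal{R}$. -}

module Defs where

open import Data.Nat using (ℕ; zero; suc; pred; _<ᵇ_; _≡ᵇ_)
open import Data.Bool using (Bool; true; false; if_then_else_)
open import Data.List using (List; []; _∷_)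
open import Data.Product using (Σ; _×_; ∃; ∃-syntax; _,_)
open import Relation.Nullary using (¬_)
open import Relation.Binary.Construct.Closure.ReflexiveTransitive using (Star)

-- λμ-terms, de Bruijn indices (terms up to α-renaming).
-- λ-variables and μ-variables are indexed separately:
--   var x      : λ-variable x
--   lam M      : λ.M   (binds λ-variable 0 in M)
--   app M N    : (M)N
--   name α M   : [α]M  (α a μ-variable index)
--   mu M       : μ.M   (binds μ-variable 0 in M)
data Term : Set where
  var  : ℕ → Term
  lam  : Term → Term
  app  : Term → Term → Term
  name : ℕ → Term → Term
  mu   : Term → Term

data Type : Set where
  atom : ℕ → Type
  bot  : Type
  _⇒_  : Type → Type → Type
infixr 7 _⇒_

ext : (ℕ → ℕ) → ℕ → ℕ
ext f zero    = zero
ext f (suc k) = suc (f k)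

renλ : (ℕ → ℕ) → Term → Term
renλ f (var x)    = var (f x)
renλ f (lam M)    = lam (renλ (ext f) M)
renλ f (app M N)  = app (renλ f M) (renλ f N)
renλ f (name α M) = name α (renλ f M)
renλ f (mu M)     = mu (renλ f M)

renμ : (ℕ → ℕ) → Term → Term
renμ f (var x)    = var x
renμ f (lam M)    = lam (renμ f M)
renμ f (app M N)  = app (renμ f M) (renμ f N)
renμ f (name α M) = name (f α) (renμ f M)
renμ f (mu M)     = mu (renμ (ext f) M)

-- subst k N M : M[x_k := N]  (capture-avoiding; free λ-variables above k
-- are decremented since the binder of x_k disappears)
subst : ℕ → Term → Term → Term
subst k N (var x)    = if x <ᵇ k then var x else (if x ≡ᵇ k then N else var (pred x))
subst k N (lam M)    = lam (subst (suc k) (renλ suc N) M)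
subst k N (app M P)  = app (subst k N M) (subst k N P)
subst k N (name α M) = name α (subst k N M)
subst k N (mu M)     = mu (subst k (renμ suc N) M)

-- substR k N M : M[α_k :=_r N]  (every [α_k]P becomes [α_k](P')N)
substR : ℕ → Term → Term → Term
substR k N (var x)    = var x
substR k N (lam M)    = lam (substR k (renλ suc N) M)
substR k N (app M P)  = app (substR k N M) (substR k N P)
substR k N (name α P) =
  if α ≡ᵇ k then name α (app (substR k N P) N) else name α (substR k N P)
substR k N (mu M)     = mu (substR (suc k) (renμ suc N) M)

-- substL k N M : M[α_k :=_l N]  (every [α_k]P becomes [α_k](N)P')
substL : ℕ → Term → Term → Term
substL k N (var x)    = var x
substL k N (lam M)    = lam (substL k (renλ suc N) M)
substL k N (app M P)  = app (substL k N M) (substL k N P)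
substL k N (name α P) =
  if α ≡ᵇ k then name α (app N (substL k N P)) else name α (substL k N P)
substL k N (mu M)     = mu (substL (suc k) (renμ suc N) M)

-- renaming for ρ: μ-variable 0 (the bound α) becomes β, others decremented
ρren : ℕ → ℕ → ℕ
ρren β zero    = β
ρren β (suc k) = k

down : ℕ → ℕ → ℕ
down k α = if α <ᵇ k then α else pred α

-- erase k M : M_{α_k}  (every [α_k]P becomes P'; α_k then no longer
-- occurs, so its binder is dropped and indices above k are decremented)
erase : ℕ → Term → Term
erase k (var x)    = var x
erase k (lam M)    = lam (erase k M)
erase k (app M P)  = app (erase k M) (erase k P)
erase k (name α P) = if α ≡ᵇ k then erase k P else name (down k α) (erase k P)
erase k (mu M)     = mu (erase (suc k) M)

data FreeMu : ℕ → Term → Set where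
  lam   : ∀ {k M} → FreeMu k M → FreeMu k (lam M)
  appl  : ∀ {k M N} → FreeMu k M → FreeMu k (app M N)
  appr  : ∀ {k M N} → FreeMu k N → FreeMu k (app M N)
  here  : ∀ {k M} → FreeMu k (name k M)
  namei : ∀ {k α M} → FreeMu k M → FreeMu k (name α M)
  mu    : ∀ {k M} → FreeMu (suc k) M → FreeMu k (mu M)

data _∋_∶_ : List Type → ℕ → Type → Set where
  here  : ∀ {Γ A} → (A ∷ Γ) ∋ zero ∶ A
  there : ∀ {Γ A B n} → Γ ∋ n ∶ A → (B ∷ Γ) ∋ suc n ∶ A

data _⊢_∶_∣_ : List Type → Term → Type → List Type → Set where
  ⊢var  : ∀ {Γ Θ x A} → Γ ∋ x ∶ A → Γ ⊢ var x ∶ A ∣ Θ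
  ⊢lam  : ∀ {Γ Θ M A B} → (A ∷ Γ) ⊢ M ∶ B ∣ Θ → Γ ⊢ lam M ∶ A ⇒ B ∣ Θ
  ⊢app  : ∀ {Γ Θ M N A B} → Γ ⊢ M ∶ A ⇒ B ∣ Θ → Γ ⊢ N ∶ A ∣ Θ
        → Γ ⊢ app M N ∶ B ∣ Θ
  ⊢name : ∀ {Γ Θ α M A} → Θ ∋ α ∶ A → Γ ⊢ M ∶ A ∣ Θ → Γ ⊢ name α M ∶ bot ∣ Θ
  ⊢mu   : ∀ {Γ Θ M A} → Γ ⊢ M ∶ bot ∣ (A ∷ Θ) → Γ ⊢ mu M ∶ A ∣ Θ

Typable : Term → Set
Typable M = ∃[ Γ ] ∃[ Θ ] ∃[ A ] (Γ ⊢ M ∶ A ∣ Θ)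

data _↦_ : Term → Term → Set where
  β   : ∀ {M N} → app (lam M) N ↦ subst 0 N M
  μ   : ∀ {M N} → app (mu M) N ↦ mu (substR 0 (renμ suc N) M)
  μ'  : ∀ {M N} → app N (mu M) ↦ mu (substL 0 (renμ suc N) M)
  ρ   : ∀ {β M} → name β (mu M) ↦ renμ (ρren β) M
  θ   : ∀ {M} → ¬ FreeMu 0 M → mu (name 0 M) ↦ renμ pred M
  ε   : ∀ {M} → mu (mu M) ↦ mu (erase 0 M)

Redex : Term → Set
Redex M = ∃[ N ] (M ↦ N)

data _⟶_ : Term → Term → Set where
  root  : ∀ {M N} → M ↦ N → M ⟶ N
  lam   : ∀ {M M'} → M ⟶ M' → lam M ⟶ lam M'
  appl  : ∀ {M M' N} → M ⟶ M' → app M N ⟶ app M' N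
  appr  : ∀ {M N N'} → N ⟶ N' → app M N ⟶ app M N'
  name  : ∀ {α M M'} → M ⟶ M' → name α M ⟶ name α M'
  mu    : ∀ {M M'} → M ⟶ M' → mu M ⟶ mu M'

_⟶*_ : Term → Term → Set
_⟶*_ = Star _⟶_

data _⊑_ : Term → Term → Set where
  refl  : ∀ {M} → M ⊑ M
  lam   : ∀ {P M} → P ⊑ M → P ⊑ lam M
  appl  : ∀ {P M N} → P ⊑ M → P ⊑ app M N
  appr  : ∀ {P M N} → P ⊑ N → P ⊑ app M N
  name  : ∀ {P α M} → P ⊑ M → P ⊑ name α M
  mu    : ∀ {P M} → P ⊑ M → P ⊑ mu M

Normal : Term → Set
Normal M = ∀ P → P ⊑ M → ¬ Redex P

WN : Term → Set
WN M = ∃[ N ] (M ⟶* N × Normal N)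

-- Normalisation by hereditary substitution.  The key lemma is that
-- substituting a normal term N : A into a normal term yields a normalising
-- term; it is proved by induction on A and, inside, on the normal form.  New
-- redexes appear only where the substituted variable ends up heading an
-- application.  Such a head has a type ⊴ A, so it meets its arguments at types
-- ◁ A: the β-redex is a substitution at a smaller type, and the μ-redex
-- (μα.c)N turns each [α]P into [α](P)N, which is again a β-redex at the
-- smaller type of N or has a neutral head.  Every other head is safe (neutral,
-- or μα.c with every [α]P neutral), and applying a safe head only produces
-- applications with neutral heads.  The rules μ', ρ, θ, ε merely rearrange
-- normal forms and are normalised directly; the theorem then follows by
-- induction on the typing derivation.

module Submission where

open import Defs
open import Data.Nat using (ℕ; zero; suc; pred; _<ᵇ_; _≡ᵇ_; _<_; s≤s; _≟_)
open import Data.Nat.Properties using (suc-injective; <ᵇ-reflects-<; ≮⇒≥; ≤∧≢⇒<)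
open import Data.Bool using (true; false)
open import Data.List using ([]; _∷_; _++_; length)
open import Data.Product using (∃-syntax; _×_; _,_; proj₁)
open import Data.Sum using (_⊎_; inj₁; inj₂; map₂)
open import Data.Empty using (⊥-elim)
open import Function using (_∘_; case_of_)
open import Relation.Nullary using (¬_; Dec; yes; no; proof; ofʸ; ofⁿ)
open import Relation.Binary.PropositionalEquality using (_≡_; _≢_; refl; sym; cong)
open import Relation.Binary.Construct.Closure.ReflexiveTransitive using (ε; _◅_; _◅◅_; gmap)

-- Subject reduction

∋-middle : ∀ Δ {Δ′ A} → (Δ ++ A ∷ Δ′) ∋ length Δ ∶ A
∋-middle []      = here
∋-middle (_ ∷ Δ) = there (∋-middle Δ)

∋-middle-unique : ∀ Δ {Δ′ A B} → (Δ ++ A ∷ Δ′) ∋ length Δ ∶ B → B ≡ A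
∋-middle-unique []      here      = refl
∋-middle-unique (_ ∷ Δ) (there p) = ∋-middle-unique Δ p

∋-replace : ∀ Δ {Δ′ A B C i} → i ≢ length Δ
          → (Δ ++ A ∷ Δ′) ∋ i ∶ C → (Δ ++ B ∷ Δ′) ∋ i ∶ C
∋-replace []      i≢ here      = ⊥-elim (i≢ refl)
∋-replace []      i≢ (there p) = there p
∋-replace (_ ∷ Δ) i≢ here      = here
∋-replace (_ ∷ Δ) i≢ (there p) = there (∋-replace Δ (i≢ ∘ cong suc) p)

∋-remove< : ∀ Δ {Δ′ A C i} → i < length Δ
          → (Δ ++ A ∷ Δ′) ∋ i ∶ C → (Δ ++ Δ′) ∋ i ∶ C
∋-remove< (_ ∷ Δ) _         here      = here
∋-remove< (_ ∷ Δ) (s≤s i<Δ) (there p) = there (∋-remove< Δ i<Δ p)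

∋-remove> : ∀ Δ {Δ′ A C i} → length Δ < i
          → (Δ ++ A ∷ Δ′) ∋ i ∶ C → (Δ ++ Δ′) ∋ pred i ∶ C
∋-remove> []      {i = suc _}       _         (there p) = p
∋-remove> (_ ∷ Δ) {i = suc zero}    (s≤s ())  (there _)
∋-remove> (_ ∷ Δ) {i = suc (suc _)} (s≤s Δ<i) (there p) = there (∋-remove> Δ Δ<i p)

∋-remove : ∀ Δ {Δ′ A C i} → i ≢ length Δ
         → (Δ ++ A ∷ Δ′) ∋ i ∶ C → (Δ ++ Δ′) ∋ down (length Δ) i ∶ C
∋-remove Δ {i = i} i≢ p with i <ᵇ length Δ | <ᵇ-reflects-< i (length Δ)
... | true  | ofʸ i<Δ = ∋-remove< Δ i<Δ p
... | false | ofⁿ i≮Δ = ∋-remove> Δ (≤∧≢⇒< (≮⇒≥ i≮Δ) (i≢ ∘ sym)) p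

data SubstVar (k : ℕ) (N : Term) : ℕ → Term → Set where
  below : ∀ {x} → x < k → SubstVar k N x (var x)
  hit   : SubstVar k N k N
  above : ∀ {x} → k < x → SubstVar k N x (var (pred x))

substVar : ∀ k N x → SubstVar k N x (subst k N (var x))
substVar k N x with x <ᵇ k | <ᵇ-reflects-< x k
... | true  | ofʸ x<k = below x<k
... | false | ofⁿ x≮k with x ≡ᵇ k | proof (x ≟ k)
...   | true  | ofʸ refl = hit
...   | false | ofⁿ x≢k  = above (≤∧≢⇒< (≮⇒≥ x≮k) (x≢k ∘ sym))

⊢-renλ : ∀ {f Γ Γ′ Θ M B} → (∀ {x C} → Γ ∋ x ∶ C → Γ′ ∋ f x ∶ C)
       → Γ ⊢ M ∶ B ∣ Θ → Γ′ ⊢ renλ f M ∶ B ∣ Θ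
⊢-renλ f∈ (⊢var x∈)    = ⊢var (f∈ x∈)
⊢-renλ f∈ (⊢lam ⊢M)    = ⊢lam (⊢-renλ ext∈ ⊢M)
  where ext∈ : ∀ {x C} → _ ∋ x ∶ C → _ ∋ ext _ x ∶ C
        ext∈ here      = here
        ext∈ (there p) = there (f∈ p)
⊢-renλ f∈ (⊢app ⊢M ⊢N) = ⊢app (⊢-renλ f∈ ⊢M) (⊢-renλ f∈ ⊢N)
⊢-renλ f∈ (⊢name α∈ ⊢M) = ⊢name α∈ (⊢-renλ f∈ ⊢M)
⊢-renλ f∈ (⊢mu ⊢M)     = ⊢mu (⊢-renλ f∈ ⊢M)

⊢-renμ : ∀ {f Γ Θ Θ′ M B} → (∀ {α C} → FreeMu α M → Θ ∋ α ∶ C → Θ′ ∋ f α ∶ C)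
       → Γ ⊢ M ∶ B ∣ Θ → Γ ⊢ renμ f M ∶ B ∣ Θ′
⊢-renμ f∈ (⊢var x∈)     = ⊢var x∈
⊢-renμ f∈ (⊢lam ⊢M)     = ⊢lam (⊢-renμ (f∈ ∘ lam) ⊢M)
⊢-renμ f∈ (⊢app ⊢M ⊢N)  = ⊢app (⊢-renμ (f∈ ∘ appl) ⊢M) (⊢-renμ (f∈ ∘ appr) ⊢N)
⊢-renμ f∈ (⊢name α∈ ⊢M) = ⊢name (f∈ here α∈) (⊢-renμ (f∈ ∘ namei) ⊢M)
⊢-renμ f∈ (⊢mu ⊢M)      = ⊢mu (⊢-renμ ext∈ ⊢M)
  where ext∈ : ∀ {α C} → FreeMu α _ → _ ∋ α ∶ C → _ ∋ ext _ α ∶ C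
        ext∈ _  here      = here
        ext∈ fr (there p) = there (f∈ (mu fr) p)

⊢-weakenλ : ∀ {Γ Θ M B C} → Γ ⊢ M ∶ B ∣ Θ → (C ∷ Γ) ⊢ renλ suc M ∶ B ∣ Θ
⊢-weakenλ = ⊢-renλ there

⊢-weakenμ : ∀ {Γ Θ M B C} → Γ ⊢ M ∶ B ∣ Θ → Γ ⊢ renμ suc M ∶ B ∣ (C ∷ Θ)
⊢-weakenμ = ⊢-renμ λ _ → there

⊢-subst : ∀ Γ₁ {Γ₂ Θ A B M N} → (Γ₁ ++ A ∷ Γ₂) ⊢ M ∶ B ∣ Θ → (Γ₁ ++ Γ₂) ⊢ N ∶ A ∣ Θ
        → (Γ₁ ++ Γ₂) ⊢ subst (length Γ₁) N M ∶ B ∣ Θ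
⊢-subst Γ₁ {N = N} (⊢var {x = x} x∈) ⊢N with subst (length Γ₁) N (var x) | substVar (length Γ₁) N x
... | _ | below x<k = ⊢var (∋-remove< Γ₁ x<k x∈)
... | _ | hit rewrite ∋-middle-unique Γ₁ x∈ = ⊢N
... | _ | above k<x = ⊢var (∋-remove> Γ₁ k<x x∈)
⊢-subst Γ₁ (⊢lam {A = C} ⊢M) ⊢N = ⊢lam (⊢-subst (C ∷ Γ₁) ⊢M (⊢-weakenλ ⊢N))
⊢-subst Γ₁ (⊢app ⊢M ⊢P)      ⊢N = ⊢app (⊢-subst Γ₁ ⊢M ⊢N) (⊢-subst Γ₁ ⊢P ⊢N)
⊢-subst Γ₁ (⊢name α∈ ⊢M)     ⊢N = ⊢name α∈ (⊢-subst Γ₁ ⊢M ⊢N)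
⊢-subst Γ₁ (⊢mu ⊢M)          ⊢N = ⊢mu (⊢-subst Γ₁ ⊢M (⊢-weakenμ ⊢N))

⊢-substR : ∀ Δ {Δ′ Γ B C D M N} → Γ ⊢ M ∶ B ∣ (Δ ++ (C ⇒ D) ∷ Δ′) → Γ ⊢ N ∶ C ∣ (Δ ++ D ∷ Δ′)
         → Γ ⊢ substR (length Δ) N M ∶ B ∣ (Δ ++ D ∷ Δ′)
⊢-substR Δ (⊢var x∈)    ⊢N = ⊢var x∈
⊢-substR Δ (⊢lam ⊢M)    ⊢N = ⊢lam (⊢-substR Δ ⊢M (⊢-weakenλ ⊢N))
⊢-substR Δ (⊢app ⊢M ⊢P) ⊢N = ⊢app (⊢-substR Δ ⊢M ⊢N) (⊢-substR Δ ⊢P ⊢N)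
⊢-substR Δ (⊢name {α = α} α∈ ⊢M) ⊢N with α ≡ᵇ length Δ | proof (α ≟ length Δ)
... | true  | ofʸ refl rewrite ∋-middle-unique Δ α∈ =
  ⊢name (∋-middle Δ) (⊢app (⊢-substR Δ ⊢M ⊢N) ⊢N)
... | false | ofⁿ α≢ = ⊢name (∋-replace Δ α≢ α∈) (⊢-substR Δ ⊢M ⊢N)
⊢-substR Δ (⊢mu {A = A} ⊢M) ⊢N = ⊢mu (⊢-substR (A ∷ Δ) ⊢M (⊢-weakenμ ⊢N))

⊢-substL : ∀ Δ {Δ′ Γ B C D M N} → Γ ⊢ M ∶ B ∣ (Δ ++ C ∷ Δ′) → Γ ⊢ N ∶ C ⇒ D ∣ (Δ ++ D ∷ Δ′)
         → Γ ⊢ substL (length Δ) N M ∶ B ∣ (Δ ++ D ∷ Δ′)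
⊢-substL Δ (⊢var x∈)    ⊢N = ⊢var x∈
⊢-substL Δ (⊢lam ⊢M)    ⊢N = ⊢lam (⊢-substL Δ ⊢M (⊢-weakenλ ⊢N))
⊢-substL Δ (⊢app ⊢M ⊢P) ⊢N = ⊢app (⊢-substL Δ ⊢M ⊢N) (⊢-substL Δ ⊢P ⊢N)
⊢-substL Δ (⊢name {α = α} α∈ ⊢M) ⊢N with α ≡ᵇ length Δ | proof (α ≟ length Δ)
... | true  | ofʸ refl rewrite ∋-middle-unique Δ α∈ =
  ⊢name (∋-middle Δ) (⊢app ⊢N (⊢-substL Δ ⊢M ⊢N))
... | false | ofⁿ α≢ = ⊢name (∋-replace Δ α≢ α∈) (⊢-substL Δ ⊢M ⊢N)
⊢-substL Δ (⊢mu {A = A} ⊢M) ⊢N = ⊢mu (⊢-substL (A ∷ Δ) ⊢M (⊢-weakenμ ⊢N))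

⊢-erase : ∀ Δ {Δ′ Γ B M} → Γ ⊢ M ∶ B ∣ (Δ ++ bot ∷ Δ′) → Γ ⊢ erase (length Δ) M ∶ B ∣ (Δ ++ Δ′)
⊢-erase Δ (⊢var x∈)    = ⊢var x∈
⊢-erase Δ (⊢lam ⊢M)    = ⊢lam (⊢-erase Δ ⊢M)
⊢-erase Δ (⊢app ⊢M ⊢P) = ⊢app (⊢-erase Δ ⊢M) (⊢-erase Δ ⊢P)
⊢-erase Δ (⊢name {α = α} α∈ ⊢M) with α ≡ᵇ length Δ | proof (α ≟ length Δ)
... | true  | ofʸ refl rewrite ∋-middle-unique Δ α∈ = ⊢-erase Δ ⊢M
... | false | ofⁿ α≢ = ⊢name (∋-remove Δ α≢ α∈) (⊢-erase Δ ⊢M)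
⊢-erase Δ (⊢mu {A = A} ⊢M) = ⊢mu (⊢-erase (A ∷ Δ) ⊢M)

↦-preserves-⊢ : ∀ {Γ Θ M N A} → M ↦ N → Γ ⊢ M ∶ A ∣ Θ → Γ ⊢ N ∶ A ∣ Θ
↦-preserves-⊢ β  (⊢app (⊢lam ⊢M) ⊢N) = ⊢-subst [] ⊢M ⊢N
↦-preserves-⊢ μ  (⊢app (⊢mu ⊢M) ⊢N) = ⊢mu (⊢-substR [] ⊢M (⊢-weakenμ ⊢N))
↦-preserves-⊢ μ' (⊢app ⊢N (⊢mu ⊢M)) = ⊢mu (⊢-substL [] ⊢M (⊢-weakenμ ⊢N))
↦-preserves-⊢ ρ  (⊢name β∈ (⊢mu ⊢M)) = ⊢-renμ ρ∈ ⊢M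
  where ρ∈ : ∀ {α C} → FreeMu α _ → (_ ∷ _) ∋ α ∶ C → _ ∋ ρren _ α ∶ C
        ρ∈ _ here      = β∈
        ρ∈ _ (there p) = p
↦-preserves-⊢ (θ 0∉M) (⊢mu (⊢name here ⊢M)) = ⊢-renμ pred∈ ⊢M
  where pred∈ : ∀ {α C} → FreeMu α _ → (_ ∷ _) ∋ α ∶ C → _ ∋ pred α ∶ C
        pred∈ 0∈M here      = ⊥-elim (0∉M 0∈M)
        pred∈ _   (there p) = p
↦-preserves-⊢ ε (⊢mu (⊢mu ⊢M)) = ⊢mu (⊢-erase [] ⊢M)

⟶-preserves-⊢ : ∀ {Γ Θ M N A} → M ⟶ N → Γ ⊢ M ∶ A ∣ Θ → Γ ⊢ N ∶ A ∣ Θ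
⟶-preserves-⊢ (root r) ⊢M           = ↦-preserves-⊢ r ⊢M
⟶-preserves-⊢ (lam s)  (⊢lam ⊢M)    = ⊢lam (⟶-preserves-⊢ s ⊢M)
⟶-preserves-⊢ (appl s) (⊢app ⊢M ⊢N) = ⊢app (⟶-preserves-⊢ s ⊢M) ⊢N
⟶-preserves-⊢ (appr s) (⊢app ⊢M ⊢N) = ⊢app ⊢M (⟶-preserves-⊢ s ⊢N)
⟶-preserves-⊢ (name s) (⊢name α∈ ⊢M) = ⊢name α∈ (⟶-preserves-⊢ s ⊢M)
⟶-preserves-⊢ (mu s)   (⊢mu ⊢M)     = ⊢mu (⟶-preserves-⊢ s ⊢M)

⟶*-preserves-⊢ : ∀ {Γ Θ M N A} → M ⟶* N → Γ ⊢ M ∶ A ∣ Θ → Γ ⊢ N ∶ A ∣ Θ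
⟶*-preserves-⊢ ε        ⊢M = ⊢M
⟶*-preserves-⊢ (s ◅ ss) ⊢M = ⟶*-preserves-⊢ ss (⟶-preserves-⊢ s ⊢M)

-- Normal forms

freeMu? : ∀ α M → Dec (FreeMu α M)
freeMu? α (var x) = no λ ()
freeMu? α (lam M) with freeMu? α M
... | yes p = yes (lam p)
... | no ¬p = no λ { (lam p) → ¬p p }
freeMu? α (app M N) with freeMu? α M | freeMu? α N
... | yes p | _     = yes (appl p)
... | no _  | yes q = yes (appr q)
... | no ¬p | no ¬q = no λ { (appl p) → ¬p p ; (appr q) → ¬q q }
freeMu? α (name γ M) with γ ≟ α | freeMu? α M
... | yes refl | _     = yes here
... | no _     | yes p = yes (namei p)
... | no γ≢α   | no ¬p = no λ { here → γ≢α refl ; (namei p) → ¬p p }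
freeMu? α (mu M) with freeMu? (suc α) M
... | yes p = yes (mu p)
... | no ¬p = no λ { (mu p) → ¬p p }

FreeMu-renμ : ∀ {g α M} → FreeMu α M → FreeMu (g α) (renμ g M)
FreeMu-renμ (lam p)   = lam (FreeMu-renμ p)
FreeMu-renμ (appl p)  = appl (FreeMu-renμ p)
FreeMu-renμ (appr p)  = appr (FreeMu-renμ p)
FreeMu-renμ here      = here
FreeMu-renμ (namei p) = namei (FreeMu-renμ p)
FreeMu-renμ (mu p)    = mu (FreeMu-renμ p)

FreeMu-renλ : ∀ {f α M} → FreeMu α M → FreeMu α (renλ f M)
FreeMu-renλ (lam p)   = lam (FreeMu-renλ p)
FreeMu-renλ (appl p)  = appl (FreeMu-renλ p)
FreeMu-renλ (appr p)  = appr (FreeMu-renλ p)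
FreeMu-renλ here      = here
FreeMu-renλ (namei p) = namei (FreeMu-renλ p)
FreeMu-renλ (mu p)    = mu (FreeMu-renλ p)

FreeMu-substL : ∀ {k X α M} → FreeMu α M → FreeMu α (substL k X M)
FreeMu-substL (lam p)  = lam (FreeMu-substL p)
FreeMu-substL (appl p) = appl (FreeMu-substL p)
FreeMu-substL (appr p) = appr (FreeMu-substL p)
FreeMu-substL {k} {M = name γ _} here with γ ≡ᵇ k
... | true  = here
... | false = here
FreeMu-substL {k} {M = name γ _} (namei p) with γ ≡ᵇ k
... | true  = namei (appr (FreeMu-substL p))
... | false = namei (FreeMu-substL p)
FreeMu-substL (mu p)   = mu (FreeMu-substL p)

data θBody : Term → Set where
  θ-body : ∀ {S} → ¬ FreeMu 0 S → θBody (name 0 S)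

θBody? : ∀ c → Dec (θBody c)
θBody? (name zero S) with freeMu? 0 S
... | yes 0∈S = no λ { (θ-body 0∉S) → 0∉S 0∈S }
... | no 0∉S  = yes (θ-body 0∉S)
θBody? (name (suc _) _) = no λ ()
θBody? (var _)          = no λ ()
θBody? (lam _)          = no λ ()
θBody? (app _ _)        = no λ ()
θBody? (mu _)           = no λ ()

θBody-renμ⁻ : ∀ {g c} → θBody (renμ (ext g) c) → θBody c
θBody-renμ⁻ {c = name zero _}    (θ-body 0∉S) = θ-body (0∉S ∘ FreeMu-renμ)
θBody-renμ⁻ {c = name (suc _) _} ()
θBody-renμ⁻ {c = var _}          ()
θBody-renμ⁻ {c = lam _}          ()
θBody-renμ⁻ {c = app _ _}        ()
θBody-renμ⁻ {c = mu _}           ()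

θBody-renλ⁻ : ∀ {f c} → θBody (renλ f c) → θBody c
θBody-renλ⁻ {c = name zero _}    (θ-body 0∉S) = θ-body (0∉S ∘ FreeMu-renλ)
θBody-renλ⁻ {c = name (suc _) _} ()
θBody-renλ⁻ {c = var _}          ()
θBody-renλ⁻ {c = lam _}          ()
θBody-renλ⁻ {c = app _ _}        ()
θBody-renλ⁻ {c = mu _}           ()

θBody-substL⁻ : ∀ {k X c} → θBody (substL (suc k) X c) → θBody c
θBody-substL⁻ {c = name zero _} (θ-body 0∉S) = θ-body (0∉S ∘ FreeMu-substL)
θBody-substL⁻ {k} {c = name (suc α) _} _ with α ≡ᵇ k
θBody-substL⁻ {c = name (suc _) _} () | true
θBody-substL⁻ {c = name (suc _) _} () | false
θBody-substL⁻ {c = var _}   ()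
θBody-substL⁻ {c = lam _}   ()
θBody-substL⁻ {c = app _ _} ()
θBody-substL⁻ {c = mu _}    ()

-- `nonμ` terms are the normal forms that are not μ-abstractions: exactly
-- those that may stand in argument position, under [α] or under μ.
data Form : Set where
  neutral nonμ normal : Form

data NF : Form → Term → Set where
  var   : ∀ {x} → NF neutral (var x)
  app   : ∀ {n v} → NF neutral n → NF nonμ v → NF neutral (app n v)
  ne↑   : ∀ {n} → NF neutral n → NF nonμ n
  lam   : ∀ {b} → NF normal b → NF nonμ (lam b)
  name  : ∀ {α v} → NF nonμ v → NF nonμ (name α v)
  nonμ↑ : ∀ {M} → NF nonμ M → NF normal M
  mu    : ∀ {c} → NF nonμ c → ¬ θBody c → NF normal (mu c)

NF-normal : ∀ {f M} → NF f M → NF normal M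
NF-normal {neutral} n = nonμ↑ (ne↑ n)
NF-normal {nonμ}    v = nonμ↑ v
NF-normal {normal}  p = p

NF⇒¬Redex : ∀ {M} → NF normal M → ¬ Redex M
NF⇒¬Redex (nonμ↑ (ne↑ (app () _)))         (_ , β)
NF⇒¬Redex (nonμ↑ (ne↑ (app () _)))         (_ , μ)
NF⇒¬Redex (nonμ↑ (ne↑ (app _ (ne↑ ()))))   (_ , μ')
NF⇒¬Redex (nonμ↑ (name (ne↑ ())))          (_ , ρ)
NF⇒¬Redex (mu _ ¬θ)                        (_ , θ 0∉S) = ¬θ (θ-body 0∉S)
NF⇒¬Redex (mu (ne↑ ()) _)                  (_ , ε)

NF-⊑ : ∀ {f M P} → NF f M → P ⊑ M → NF normal P
NF-⊑ p         refl     = NF-normal p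
NF-⊑ (ne↑ p)   P⊑       = NF-⊑ p P⊑
NF-⊑ (nonμ↑ p) P⊑       = NF-⊑ p P⊑
NF-⊑ (app n v) (appl P⊑) = NF-⊑ n P⊑
NF-⊑ (app n v) (appr P⊑) = NF-⊑ v P⊑
NF-⊑ (lam p)   (lam P⊑)  = NF-⊑ p P⊑
NF-⊑ (name p)  (name P⊑) = NF-⊑ p P⊑
NF-⊑ (mu p _)  (mu P⊑)   = NF-⊑ p P⊑

NF⇒Normal : ∀ {M} → NF normal M → Normal M
NF⇒Normal p P P⊑ = NF⇒¬Redex (NF-⊑ p P⊑)

NF-renμ : ∀ {g f M} → NF f M → NF f (renμ g M)
NF-renμ var       = var
NF-renμ (app n v) = app (NF-renμ n) (NF-renμ v)
NF-renμ (ne↑ p)   = ne↑ (NF-renμ p)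
NF-renμ (lam p)   = lam (NF-renμ p)
NF-renμ (name p)  = name (NF-renμ p)
NF-renμ (nonμ↑ p) = nonμ↑ (NF-renμ p)
NF-renμ (mu p ¬θ) = mu (NF-renμ p) (¬θ ∘ θBody-renμ⁻)

NF-renλ : ∀ {f′ f M} → NF f M → NF f (renλ f′ M)
NF-renλ var       = var
NF-renλ (app n v) = app (NF-renλ n) (NF-renλ v)
NF-renλ (ne↑ p)   = ne↑ (NF-renλ p)
NF-renλ (lam p)   = lam (NF-renλ p)
NF-renλ (name p)  = name (NF-renλ p)
NF-renλ (nonμ↑ p) = nonμ↑ (NF-renλ p)
NF-renλ (mu p ¬θ) = mu (NF-renλ p) (¬θ ∘ θBody-renλ⁻)

-- Substituting a neutral X creates only applications (X)P′, which are neutral.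
NF-substL : ∀ {k X f M} → NF neutral X → NF f M → NF f (substL k X M)
NF-substL nX var       = var
NF-substL nX (app n v) = app (NF-substL nX n) (NF-substL nX v)
NF-substL nX (ne↑ p)   = ne↑ (NF-substL nX p)
NF-substL nX (lam p)   = lam (NF-substL (NF-renλ nX) p)
NF-substL {k} nX (name {α} p) with α ≡ᵇ k
... | true  = name (ne↑ (app nX (NF-substL nX p)))
... | false = name (NF-substL nX p)
NF-substL nX (nonμ↑ p) = nonμ↑ (NF-substL nX p)
NF-substL nX (mu p ¬θ) = mu (NF-substL (NF-renμ nX) p) (¬θ ∘ θBody-substL⁻)

data NeutralSites : ℕ → Term → Set where
  var  : ∀ {k x} → NeutralSites k (var x)
  lam  : ∀ {k b} → NeutralSites k b → NeutralSites k (lam b)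
  app  : ∀ {k M N} → NeutralSites k M → NeutralSites k N → NeutralSites k (app M N)
  site : ∀ {k P} → NF neutral P → NeutralSites k P → NeutralSites k (name k P)
  name : ∀ {k α P} → α ≢ k → NeutralSites k P → NeutralSites k (name α P)
  mu   : ∀ {k c} → NeutralSites (suc k) c → NeutralSites k (mu c)

NS-lam : ∀ {k b} → NeutralSites k (lam b) → NeutralSites k b
NS-lam (lam s) = s

NS-appˡ : ∀ {k M N} → NeutralSites k (app M N) → NeutralSites k M
NS-appˡ (app s _) = s

NS-appʳ : ∀ {k M N} → NeutralSites k (app M N) → NeutralSites k N
NS-appʳ (app _ s) = s

NS-site : ∀ {k P} → NeutralSites k (name k P) → NF neutral P
NS-site (site n _)  = n
NS-site (name k≢k _) = ⊥-elim (k≢k refl)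

NS-body : ∀ {k α P} → NeutralSites k (name α P) → NeutralSites k P
NS-body (site _ s) = s
NS-body (name _ s) = s

NS-mu : ∀ {k c} → NeutralSites k (mu c) → NeutralSites (suc k) c
NS-mu (mu s) = s

¬FreeMu⇒NS : ∀ {k M} → ¬ FreeMu k M → NeutralSites k M
¬FreeMu⇒NS {M = var _}   k∉M = var
¬FreeMu⇒NS {M = lam _}   k∉M = lam (¬FreeMu⇒NS (k∉M ∘ lam))
¬FreeMu⇒NS {M = app _ _} k∉M = app (¬FreeMu⇒NS (k∉M ∘ appl)) (¬FreeMu⇒NS (k∉M ∘ appr))
¬FreeMu⇒NS {k} {M = name α _} k∉M with α ≟ k
... | yes refl = ⊥-elim (k∉M here)
... | no α≢k   = name α≢k (¬FreeMu⇒NS (k∉M ∘ namei))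
¬FreeMu⇒NS {M = mu _}    k∉M = mu (¬FreeMu⇒NS (k∉M ∘ mu))

NS-renμ : ∀ {g j M} → (∀ i → g i ≡ j → NeutralSites i M) → NeutralSites j (renμ g M)
NS-renμ {M = var _}   s = var
NS-renμ {M = lam _}   s = lam (NS-renμ λ i e → NS-lam (s i e))
NS-renμ {M = app _ _} s = app (NS-renμ λ i e → NS-appˡ (s i e)) (NS-renμ λ i e → NS-appʳ (s i e))
NS-renμ {g} {j} {M = name α _} s with g α ≟ j
... | yes refl = site (NF-renμ (NS-site (s α refl))) (NS-renμ λ i e → NS-body (s i e))
... | no gα≢j  = name gα≢j (NS-renμ λ i e → NS-body (s i e))
NS-renμ {g} {j} {M = mu _} s = mu (NS-renμ ext-s)
  where ext-s : ∀ i → ext g i ≡ suc j → NeutralSites i _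
        ext-s zero    ()
        ext-s (suc i) e = NS-mu (s i (suc-injective e))

NS-weaken₀ : ∀ {M} → NeutralSites 0 (renμ suc M)
NS-weaken₀ = NS-renμ λ _ ()

NS-weaken : ∀ {k M} → NeutralSites k M → NeutralSites (suc k) (renμ suc M)
NS-weaken s = NS-renμ λ { _ refl → s }

NS-renλ : ∀ {f k M} → NeutralSites k M → NeutralSites k (renλ f M)
NS-renλ var          = var
NS-renλ (lam s)      = lam (NS-renλ s)
NS-renλ (app s t)    = app (NS-renλ s) (NS-renλ t)
NS-renλ (site n s)   = site (NF-renλ n) (NS-renλ s)
NS-renλ (name α≢ s)  = name α≢ (NS-renλ s)
NS-renλ (mu s)       = mu (NS-renλ s)

-- The sites of k itself are neutral afterwards whatever M is, which is why
-- the hypothesis on M is only needed when j ≢ k.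
NS-substL : ∀ {j k X f M} → NF neutral X → NeutralSites j X → NF f M
          → (j ≢ k → NeutralSites j M) → NeutralSites j (substL k X M)
NS-substL nX sX var       sM = var
NS-substL nX sX (app n v) sM =
  app (NS-substL nX sX n (NS-appˡ ∘ sM)) (NS-substL nX sX v (NS-appʳ ∘ sM))
NS-substL nX sX (ne↑ p)   sM = NS-substL nX sX p sM
NS-substL nX sX (nonμ↑ p) sM = NS-substL nX sX p sM
NS-substL nX sX (lam p)   sM = lam (NS-substL (NF-renλ nX) (NS-renλ sX) p (NS-lam ∘ sM))
NS-substL {j} {k} nX sX (name {α} p) sM with α ≡ᵇ k | proof (α ≟ k) | α ≟ j
... | true  | _       | yes refl =
  site (app nX (NF-substL nX p)) (app sX (NS-substL nX sX p (NS-body ∘ sM)))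
... | true  | _       | no α≢j   = name α≢j (app sX (NS-substL nX sX p (NS-body ∘ sM)))
... | false | ofⁿ α≢k | yes refl =
  site (NF-substL nX (NS-site (sM α≢k))) (NS-substL nX sX p (NS-body ∘ sM))
... | false | _       | no α≢j   = name α≢j (NS-substL nX sX p (NS-body ∘ sM))
NS-substL nX sX (mu p _)  sM =
  mu (NS-substL (NF-renμ nX) (NS-weaken sX) p (NS-mu ∘ sM ∘ (_∘ cong suc)))

lam* : ∀ {M M′} → M ⟶* M′ → lam M ⟶* lam M′
lam* = gmap lam lam

app* : ∀ {M M′ N N′} → M ⟶* M′ → N ⟶* N′ → app M N ⟶* app M′ N′
app* M⟶* N⟶* = gmap (λ M → app M _) appl M⟶* ◅◅ gmap (app _) appr N⟶*

name* : ∀ {α M M′} → M ⟶* M′ → name α M ⟶* name α M′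
name* = gmap (name _) name

mu* : ∀ {M M′} → M ⟶* M′ → mu M ⟶* mu M′
mu* = gmap mu mu

step : ∀ {M N} → M ↦ N → M ⟶* N
step r = root r ◅ ε

infix  3 _⇓_
infixr 4 _◅⇓_

_⇓_ : Term → (Term → Set) → Set
M ⇓ Q = ∃[ r ] (M ⟶* r × Q r)

_◅⇓_ : ∀ {M M′ Q} → M ⟶* M′ → M′ ⇓ Q → M ⇓ Q
s ◅⇓ (r , s′ , q) = r , s ◅◅ s′ , q

⇓-map : ∀ {M Q Q′} → (∀ {r} → Q r → Q′ r) → M ⇓ Q → M ⇓ Q′
⇓-map f (r , s , q) = r , s , f q

-- Applying a safe head to a normal term never needs the normalisation of a
-- substitution: μ-reduction only produces applications with neutral heads.
data SafeHead : Term → Set where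
  ne : ∀ {n} → NF neutral n → SafeHead n
  mu : ∀ {c} → NeutralSites 0 c → SafeHead (mu c)

mu-nonμ-normalises : ∀ {d} → NF nonμ d
  → mu d ⇓ λ r → NF normal r × (NeutralSites 0 d → SafeHead r)
                             × (∀ j → NeutralSites (suc j) d → NeutralSites j r)
mu-nonμ-normalises {d} p with θBody? d
... | no ¬θ = mu d , ε , mu p ¬θ , mu , λ _ → mu
mu-nonμ-normalises (name p) | yes (θ-body {S} 0∉S) =
  renμ pred S , step (θ 0∉S) , nonμ↑ (NF-renμ p) , ne ∘ NF-renμ ∘ NS-site , keep
  where keep : ∀ j → NeutralSites (suc j) (name 0 S) → NeutralSites j (renμ pred S)
        keep j s = NS-renμ λ { zero _ → ¬FreeMu⇒NS 0∉S ; (suc _) refl → NS-body s }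
mu-nonμ-normalises (ne↑ ()) | yes (θ-body _)

name-normalises : ∀ α {R} → NF normal R → name α R ⇓ NF nonμ
name-normalises α (nonμ↑ p) = _ , ε , name p
name-normalises α (mu p _)  = _ , step ρ , NF-renμ p

site-normalises : ∀ k {R} → NF normal R → SafeHead R
  → name k R ⇓ λ r → NF nonμ r × (NeutralSites k R → NeutralSites k r)
site-normalises k (nonμ↑ p)        (ne n) = _ , ε , name p , site n
site-normalises k (nonμ↑ (ne↑ ())) (mu _)
site-normalises k (mu _ _)         (ne ())
site-normalises k (mu p _)         (mu s₀) =
  _ , step ρ , NF-renμ p , λ s → NS-renμ λ { zero _ → s₀ ; (suc _) refl → NS-mu s }

erase-normalises : ∀ k {f M} → NF f M → erase k M ⇓ NF f
erase-normalises k var = _ , ε , var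
erase-normalises k (app n v) =
  let _ , s₁ , q₁ = erase-normalises k n
      _ , s₂ , q₂ = erase-normalises k v
  in _ , app* s₁ s₂ , app q₁ q₂
erase-normalises k (ne↑ p)   = ⇓-map ne↑ (erase-normalises k p)
erase-normalises k (nonμ↑ p) = ⇓-map nonμ↑ (erase-normalises k p)
erase-normalises k (lam p)   = let _ , s , q = erase-normalises k p in _ , lam* s , lam q
erase-normalises k (name {α} p) with α ≡ᵇ k
... | true  = erase-normalises k p
... | false = let _ , s , q = erase-normalises k p in _ , name* s , name q
erase-normalises k (mu p _)  =
  let _ , s , q = erase-normalises (suc k) p in mu* s ◅⇓ ⇓-map proj₁ (mu-nonμ-normalises q)

mu-normalises : ∀ {d} → NF normal d → mu d ⇓ NF normal
mu-normalises (nonμ↑ p) = ⇓-map proj₁ (mu-nonμ-normalises p)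
mu-normalises (mu p _)  =
  let _ , s , q = erase-normalises 0 p in step ε ◅◅ mu* s ◅⇓ ⇓-map proj₁ (mu-nonμ-normalises q)

app-neutral-normalises : ∀ {n N} → NF neutral n → NF normal N
  → app n N ⇓ λ r → NF normal r × SafeHead r
                  × (∀ j → NeutralSites j n → NeutralSites j N → NeutralSites j r)
app-neutral-normalises n (nonμ↑ v) = _ , ε , nonμ↑ (ne↑ (app n v)) , ne (app n v) , λ _ → app
app-neutral-normalises n (mu c _) =
  let n′ = NF-renμ n
      _ , s , q , safe , keep = mu-nonμ-normalises (NF-substL n′ c)
  in _ , step μ' ◅◅ s , q , safe (NS-substL n′ NS-weaken₀ c λ 0≢0 → ⊥-elim (0≢0 refl))
     , λ j sn sN → keep j (NS-substL n′ (NS-weaken sn) c λ _ → NS-mu sN)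

-- Substitution of normal terms normalises

data _◁_ : Type → Type → Set where
  dom  : ∀ {A B} → A ◁ (A ⇒ B)
  cod  : ∀ {A B} → B ◁ (A ⇒ B)
  domT : ∀ {A B C} → C ◁ A → C ◁ (A ⇒ B)
  codT : ∀ {A B C} → C ◁ B → C ◁ (A ⇒ B)

_⊴_ : Type → Type → Set
B ⊴ A = B ≡ A ⊎ B ◁ A

◁-trans : ∀ {A B C} → A ◁ B → B ◁ C → A ◁ C
◁-trans p dom      = domT p
◁-trans p cod      = codT p
◁-trans p (domT q) = domT (◁-trans p q)
◁-trans p (codT q) = codT (◁-trans p q)

⊴-dom : ∀ {A C D} → (C ⇒ D) ⊴ A → C ◁ A
⊴-dom (inj₁ refl) = dom
⊴-dom (inj₂ le)   = ◁-trans dom le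

⊴-cod : ∀ {A C D} → (C ⇒ D) ⊴ A → D ◁ A
⊴-cod (inj₁ refl) = cod
⊴-cod (inj₂ le)   = ◁-trans cod le

SubstNormalises : Type → Set
SubstNormalises A = ∀ Γ₁ {Γ₂ Θ b B N}
  → (Γ₁ ++ A ∷ Γ₂) ⊢ b ∶ B ∣ Θ → (Γ₁ ++ Γ₂) ⊢ N ∶ A ∣ Θ → NF normal N → NF normal b
  → subst (length Γ₁) N b ⇓ NF normal

-- With `SubstNormalises C` every site may be a β-redex at type C; without it
-- the sites must be neutral, and then no substitution has to be normalised.
mutual
  substR-normalises : ∀ Δ {Δ′ Γ B C D N M f} → let k = length Δ in
      Γ ⊢ M ∶ B ∣ (Δ ++ (C ⇒ D) ∷ Δ′) → Γ ⊢ N ∶ C ∣ (Δ ++ D ∷ Δ′)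
    → NF normal N → NeutralSites k N → NF f M → SubstNormalises C ⊎ NeutralSites k M
    → substR k N M ⇓ λ r → NF f r × (NeutralSites k M → NeutralSites k r)
  substR-normalises Δ ⊢M ⊢N nN sN (ne↑ p) mode =
    ⇓-map (λ (q , keep) → ne↑ q , keep) (substR-normalises Δ ⊢M ⊢N nN sN p mode)
  substR-normalises Δ ⊢M ⊢N nN sN (nonμ↑ p) mode =
    ⇓-map (λ (q , keep) → nonμ↑ q , keep) (substR-normalises Δ ⊢M ⊢N nN sN p mode)
  substR-normalises Δ ⊢M ⊢N nN sN var mode = _ , ε , var , λ _ → var
  substR-normalises Δ (⊢app ⊢n ⊢v) ⊢N nN sN (app n v) mode =
    let _ , s₁ , q₁ , keep₁ = substR-normalises Δ ⊢n ⊢N nN sN n (map₂ NS-appˡ mode)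
        _ , s₂ , q₂ , keep₂ = substR-normalises Δ ⊢v ⊢N nN sN v (map₂ NS-appʳ mode)
    in _ , app* s₁ s₂ , app q₁ q₂ , λ s → app (keep₁ (NS-appˡ s)) (keep₂ (NS-appʳ s))
  substR-normalises Δ (⊢lam ⊢b) ⊢N nN sN (lam b) mode =
    let _ , s , q , keep =
          substR-normalises Δ ⊢b (⊢-weakenλ ⊢N) (NF-renλ nN) (NS-renλ sN) b (map₂ NS-lam mode)
    in _ , lam* s , lam q , lam ∘ keep ∘ NS-lam
  substR-normalises Δ (⊢mu {A = A} ⊢c) ⊢N nN sN (mu c _) mode =
    let _ , s , q , keep =
          substR-normalises (A ∷ Δ) ⊢c (⊢-weakenμ ⊢N) (NF-renμ nN) (NS-weaken sN) c (map₂ NS-mu mode)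
        _ , s′ , q′ , _ , keep′ = mu-nonμ-normalises q
    in _ , mu* s ◅◅ s′ , q′ , keep′ _ ∘ keep ∘ NS-mu
  substR-normalises Δ (⊢name {α = α} α∈ ⊢v) ⊢N nN sN (name v) mode
    with α ≡ᵇ length Δ | proof (α ≟ length Δ)
  ... | true  | ofʸ refl rewrite ∋-middle-unique Δ α∈ = substR-site Δ ⊢v ⊢N nN sN v mode
  ... | false | ofⁿ α≢ =
    let _ , s , q , keep = substR-normalises Δ ⊢v ⊢N nN sN v (map₂ NS-body mode)
    in _ , name* s , name q , name α≢ ∘ keep ∘ NS-body

  substR-site : ∀ Δ {Δ′ Γ C D N P} → let k = length Δ in
      Γ ⊢ P ∶ C ⇒ D ∣ (Δ ++ (C ⇒ D) ∷ Δ′) → Γ ⊢ N ∶ C ∣ (Δ ++ D ∷ Δ′)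
    → NF normal N → NeutralSites k N → NF nonμ P → SubstNormalises C ⊎ NeutralSites k (name k P)
    → name k (app (substR k N P) N)
        ⇓ λ r → NF nonμ r × (NeutralSites k (name k P) → NeutralSites k r)
  substR-site Δ ⊢P ⊢N nN sN (ne↑ n) mode =
    let _ , s₁ , q₁ , keep₁ = substR-normalises Δ ⊢P ⊢N nN sN n (map₂ NS-body mode)
        _ , s₂ , q₂ , safe , keep₂ = app-neutral-normalises q₁ nN
        _ , s₃ , q₃ , keep₃ = site-normalises (length Δ) q₂ safe
    in _ , name* (app* s₁ ε ◅◅ s₂) ◅◅ s₃ , q₃ , λ s → keep₃ (keep₂ _ (keep₁ (NS-body s)) sN)
  substR-site Δ (⊢lam ⊢b) ⊢N nN sN (lam b) (inj₂ s) with () ← NS-site s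
  substR-site Δ (⊢lam ⊢b) ⊢N nN sN (lam b) (inj₁ subst-C) =
    let _ , s₁ , q₁ , _ =
          substR-normalises Δ ⊢b (⊢-weakenλ ⊢N) (NF-renλ nN) (NS-renλ sN) b (inj₁ subst-C)
        ⊢b′ = ⟶*-preserves-⊢ s₁ (⊢-substR Δ ⊢b (⊢-weakenλ ⊢N))
        _ , s₂ , q₂ = subst-C [] ⊢b′ ⊢N nN q₁
        _ , s₃ , q₃ = name-normalises (length Δ) q₂
    in _ , name* (app* (lam* s₁) ε ◅◅ step β ◅◅ s₂) ◅◅ s₃ , q₃ , λ s → case NS-site s of λ ()
  substR-site Δ () ⊢N nN sN (name _) mode

app-normalises : ∀ {Γ Θ C D M N} → SubstNormalises C → Γ ⊢ M ∶ C ⇒ D ∣ Θ → Γ ⊢ N ∶ C ∣ Θ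
  → NF normal M → NF normal N → app M N ⇓ NF normal
app-normalises subst-C (⊢lam ⊢b) ⊢N (nonμ↑ (lam b)) nN = step β ◅⇓ subst-C [] ⊢b ⊢N nN b
app-normalises subst-C ⊢M ⊢N (nonμ↑ (ne↑ n)) nN = ⇓-map proj₁ (app-neutral-normalises n nN)
app-normalises subst-C (⊢mu ⊢c) ⊢N (mu c _) nN =
  let _ , s , q , _ =
        substR-normalises [] ⊢c (⊢-weakenμ ⊢N) (NF-renμ nN) NS-weaken₀ c (inj₁ subst-C)
  in step μ ◅◅ mu* s ◅⇓ ⇓-map proj₁ (mu-nonμ-normalises q)

app-safe-normalises : ∀ {Γ Θ C D M N} → Γ ⊢ M ∶ C ⇒ D ∣ Θ → Γ ⊢ N ∶ C ∣ Θ
  → NF normal M → SafeHead M → NF normal N → app M N ⇓ λ r → NF normal r × SafeHead r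
app-safe-normalises ⊢M ⊢N _ (ne n) nN =
  ⇓-map (λ (q , safe , _) → q , safe) (app-neutral-normalises n nN)
app-safe-normalises (⊢mu ⊢c) ⊢N (mu c _) (mu s₀) nN =
  let _ , s , q , keep = substR-normalises [] ⊢c (⊢-weakenμ ⊢N) (NF-renμ nN) NS-weaken₀ c (inj₂ s₀)
      _ , s′ , q′ , safe , _ = mu-nonμ-normalises q
  in _ , step μ ◅◅ mu* s ◅◅ s′ , q′ , safe (keep s₀)
app-safe-normalises _ _ (nonμ↑ (ne↑ ())) (mu _) _

-- Substituting N : A into a neutral term yields a head that either has a type
-- ⊴ A, so that its arguments have types ◁ A, or is safe.
module SubstAt (A : Type) (ih : ∀ {B} → B ◁ A → SubstNormalises B) where

  app-head-normalises : ∀ {Γ Θ C T M N} → Γ ⊢ M ∶ C ⇒ T ∣ Θ → Γ ⊢ N ∶ C ∣ Θ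
    → NF normal M → NF normal N → (C ⇒ T) ⊴ A ⊎ SafeHead M
    → app M N ⇓ λ r → NF normal r × (T ⊴ A ⊎ SafeHead r)
  app-head-normalises ⊢M ⊢N nM nN (inj₁ CT⊴A) =
    ⇓-map (λ q → q , inj₁ (inj₂ (⊴-cod CT⊴A))) (app-normalises (ih (⊴-dom CT⊴A)) ⊢M ⊢N nM nN)
  app-head-normalises ⊢M ⊢N nM nN (inj₂ safe) =
    ⇓-map (λ (q , safe′) → q , inj₂ safe′) (app-safe-normalises ⊢M ⊢N nM safe nN)

  mutual
    subst-neutral : ∀ Γ₁ {Γ₂ Θ n T N}
      → (Γ₁ ++ A ∷ Γ₂) ⊢ n ∶ T ∣ Θ → (Γ₁ ++ Γ₂) ⊢ N ∶ A ∣ Θ → NF normal N → NF neutral n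
      → subst (length Γ₁) N n ⇓ λ r → NF normal r × (T ⊴ A ⊎ SafeHead r)
    subst-neutral Γ₁ {N = N} (⊢var {x = x} x∈) ⊢N nN var
      with subst (length Γ₁) N (var x) | substVar (length Γ₁) N x
    ... | _ | below _ = _ , ε , nonμ↑ (ne↑ var) , inj₂ (ne var)
    ... | _ | hit rewrite ∋-middle-unique Γ₁ x∈ = N , ε , nN , inj₁ (inj₁ refl)
    ... | _ | above _ = _ , ε , nonμ↑ (ne↑ var) , inj₂ (ne var)
    subst-neutral Γ₁ (⊢app ⊢n ⊢v) ⊢N nN (app n v) =
      let _ , s₁ , q₁ , head = subst-neutral Γ₁ ⊢n ⊢N nN n
          _ , s₂ , q₂        = subst-normal Γ₁ ⊢v ⊢N nN v
          ⊢r₁ = ⟶*-preserves-⊢ s₁ (⊢-subst Γ₁ ⊢n ⊢N)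
          ⊢r₂ = ⟶*-preserves-⊢ s₂ (⊢-subst Γ₁ ⊢v ⊢N)
      in app* s₁ s₂ ◅⇓ app-head-normalises ⊢r₁ ⊢r₂ q₁ q₂ head

    subst-normal : ∀ Γ₁ {Γ₂ Θ b B N f}
      → (Γ₁ ++ A ∷ Γ₂) ⊢ b ∶ B ∣ Θ → (Γ₁ ++ Γ₂) ⊢ N ∶ A ∣ Θ → NF normal N → NF f b
      → subst (length Γ₁) N b ⇓ NF normal
    subst-normal Γ₁ ⊢b ⊢N nN var       = ⇓-map proj₁ (subst-neutral Γ₁ ⊢b ⊢N nN var)
    subst-normal Γ₁ ⊢b ⊢N nN (app n v) = ⇓-map proj₁ (subst-neutral Γ₁ ⊢b ⊢N nN (app n v))
    subst-normal Γ₁ ⊢b ⊢N nN (ne↑ n)   = ⇓-map proj₁ (subst-neutral Γ₁ ⊢b ⊢N nN n)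
    subst-normal Γ₁ ⊢b ⊢N nN (nonμ↑ p) = subst-normal Γ₁ ⊢b ⊢N nN p
    subst-normal Γ₁ (⊢lam {A = C} ⊢b) ⊢N nN (lam b) =
      let _ , s , q = subst-normal (C ∷ Γ₁) ⊢b (⊢-weakenλ ⊢N) (NF-renλ nN) b
      in _ , lam* s , nonμ↑ (lam q)
    subst-normal Γ₁ (⊢name _ ⊢v) ⊢N nN (name v) =
      let _ , s , q = subst-normal Γ₁ ⊢v ⊢N nN v
      in name* s ◅⇓ ⇓-map nonμ↑ (name-normalises _ q)
    subst-normal Γ₁ (⊢mu ⊢c) ⊢N nN (mu c _) =
      let _ , s , q = subst-normal Γ₁ ⊢c (⊢-weakenμ ⊢N) (NF-renμ nN) c
      in mu* s ◅⇓ mu-normalises q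

mutual
  subst-normalises : ∀ A → SubstNormalises A
  subst-normalises A Γ₁ = SubstAt.subst-normal A (subst-normalises-◁ A) Γ₁

  subst-normalises-◁ : ∀ A {B} → B ◁ A → SubstNormalises B
  subst-normalises-◁ (A ⇒ _) dom      = subst-normalises A
  subst-normalises-◁ (_ ⇒ B) cod      = subst-normalises B
  subst-normalises-◁ (A ⇒ _) (domT p) = subst-normalises-◁ A p
  subst-normalises-◁ (_ ⇒ B) (codT p) = subst-normalises-◁ B p

normalise : ∀ {Γ Θ M A} → Γ ⊢ M ∶ A ∣ Θ → M ⇓ NF normal
normalise (⊢var _) = _ , ε , nonμ↑ (ne↑ var)
normalise (⊢lam ⊢M) = let _ , s , q = normalise ⊢M in _ , lam* s , nonμ↑ (lam q)
normalise (⊢app {A = C} ⊢M ⊢N) =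
  let _ , s₁ , q₁ = normalise ⊢M
      _ , s₂ , q₂ = normalise ⊢N
  in app* s₁ s₂ ◅⇓ app-normalises (subst-normalises C)
                     (⟶*-preserves-⊢ s₁ ⊢M) (⟶*-preserves-⊢ s₂ ⊢N) q₁ q₂
normalise (⊢name _ ⊢M) =
  let _ , s , q = normalise ⊢M in name* s ◅⇓ ⇓-map nonμ↑ (name-normalises _ q)
normalise (⊢mu ⊢M) = let _ , s , q = normalise ⊢M in mu* s ◅⇓ mu-normalises q

theorem5p20 : (M : Term) → Typable M → WN M
theorem5p20 M (_ , _ , _ , ⊢M) = ⇓-map NF⇒Normal (normalise ⊢M)
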